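{- Let $n\ge1$, let $E=E(B(n))$ and let $X\subseteq B(n)$. Then $X$ is a face of ${\cal H}(B(n))$ if and only if $X\setminus E$ is a face of ${\cal H}(B(n))$.
   Context: For $n\ge1$, $B(n)$ denotes the aperiodic Brandt semigroup: the set $(\{1,\dots,n\}\times\{1,\dots,n\})\cup\{0\}$, where $0$ is a zero element and $(i,j)(k,l)=(i,l)$ if $j=k$ and $(i,j)(k,l)=0$ otherwise. Its set of idempotents is $E(B(n))=\{0\}\cup\{(i,i)\mid 1\le i\le n\}$. For $Y\subseteq B(n)$, $Y^+$ denotes the subsemigroup generated by $Y$ ($\emptyset^+=\emptyset$). The subsemigroup complex ${\cal H}(B(n))$ has vertex set $B(n)$, and a subset $X$ is a face iff it admits an enumeration $x_1,\dots,x_k$ with $\emptyset\subset\{x_1\}^+\subset\{x_1,x_2\}^+\subset\cdots\subset\{x_1,\dots,x_k\}^+$ (all inclusions strict). -}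

module Defs where

open import Data.Nat using (ℕ; suc)
open import Data.Fin using (Fin; _≟_)
open import Data.Maybe using (Maybe; just; nothing)
open import Data.Product using (_×_; _,_; ∃-syntax; Σ-syntax)
open import Data.Bool using (Bool; true; false; _∧_; not)
open import Data.List using (List; length; take)
open import Data.List.Membership.Propositional using (_∈_)
open import Data.List.Relation.Unary.Unique.Propositional using (Unique)
open import Relation.Nullary using (¬_)
open import Relation.Nullary.Decidable using (⌊_⌋; yes; no)
open import Relation.Binary.PropositionalEquality using (_≡_)
open import Function.Bundles using (_⇔_)

-- The aperiodic Brandt semigroup B(n): `nothing` is the zero 0,
-- `just (i , j)` is the pair (i,j).
B : ℕ → Set
B n = Maybe (Fin n × Fin n)

zeroB : ∀ {n} → B n
zeroB = nothing

_·_ : ∀ {n} → B n → B n → B n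
nothing · _ = nothing
just _ · nothing = nothing
just (i , j) · just (k , l) with j ≟ k
... | yes _ = just (i , l)
... | no _ = nothing

inE : ∀ {n} → B n → Bool
inE nothing = true
inE (just (i , j)) = ⌊ i ≟ j ⌋

Subset : ℕ → Set
Subset n = B n → Bool

_∖E : ∀ {n} → Subset n → Subset n
(X ∖E) x = X x ∧ not (inE x)

data Gen {n : ℕ} (ys : List (B n)) : B n → Set where
  base : ∀ {x} → x ∈ ys → Gen ys x
  mul  : ∀ {a b} → Gen ys a → Gen ys b → Gen ys (a · b)

_⊂_ : ∀ {n} → (B n → Set) → (B n → Set) → Set
P ⊂ Q = (∀ x → P x → Q x) × (∃[ x ] (Q x × ¬ P x))

StrictChain : ∀ {n} → List (B n) → Set
StrictChain xs = (i : Fin (length xs)) →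
  Gen (take (Data.Fin.toℕ i) xs) ⊂ Gen (take (suc (Data.Fin.toℕ i)) xs)

IsFace : ∀ {n} → Subset n → Set
IsFace X = Σ[ xs ∈ List (B _) ]
  (Unique xs × (∀ x → (x ∈ xs) ⇔ (X x ≡ true)) × StrictChain xs)

module Submission where

-- Call a list x₁,…,x_k a chain over acc if no xᵢ lies in the
-- subsemigroup generated by acc, x₁,…,x_{i-1}.  Since adding a generator
-- strictly enlarges a subsemigroup exactly when it was not generated before,
-- the faces of H(B(n)) are the sets enumerated by chains over [].
-- (1) Generated subsemigroups grow with their generators, so a subsequence of
--     a chain is again a chain; keeping the non-idempotents of an enumeration
--     of X yields an enumeration of X \ E.
-- (2) In B(n) an idempotent e satisfies e·b ∈ {0, b} and b·e ∈ {0, b}.  Hence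
--     idempotent generators contribute nothing but themselves and 0, so a
--     chain of non-idempotents stays a chain over any list of idempotents.
-- (3) The list 0, (1,1), …, (n,n) of all idempotents is a chain, so is its
--     subsequence of elements of X; followed by a chain enumerating X \ E it
--     enumerates X.

open import Defs
open import Data.Nat using (ℕ; suc; _≤_)
open import Data.Fin using (Fin; toℕ) renaming (zero to fzero; suc to fsuc; _≟_ to _≟ᶠ_)
open import Data.Maybe using (just; nothing)
open import Data.Product using (_×_; _,_; proj₁; proj₂; Σ-syntax)
open import Data.Sum using (_⊎_; inj₁; inj₂)
open import Data.Bool using (true; false; _∧_; not) renaming (_≟_ to _≟ᵇ_)
open import Data.Unit using (⊤; tt)
open import Data.List using (List; []; _∷_; _++_; [_]; length; take; map; allFin; filter)
open import Data.List.Properties using (++-assoc; ++-identityʳ)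
open import Data.List.Membership.Propositional using (_∈_; _∉_)
open import Data.List.Membership.Propositional.Properties
  using (∈-++⁻; ∈-++⁺ˡ; ∈-++⁺ʳ; ∈-map⁻; ∈-map⁺; ∈-allFin; ∈-filter⁻; ∈-filter⁺)
open import Data.List.Relation.Unary.Any using (here; there)
open import Data.List.Relation.Unary.All using (All; []; _∷_)
import Data.List.Relation.Unary.All as All
open import Data.List.Relation.Unary.Unique.Propositional using (Unique; []; _∷_)
open import Data.List.Relation.Unary.Unique.Propositional.Properties using (allFin⁺; map⁺)
open import Data.List.Relation.Binary.Subset.Propositional using (_⊆_)
open import Data.List.Relation.Binary.Subset.Propositional.Properties using (xs⊆xs++ys; ++⁺ˡ)
open import Data.List.Relation.Binary.Sublist.Propositional using ([]; _∷ʳ_; _∷_)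
  renaming (_⊆_ to _⊑_)
open import Data.List.Relation.Binary.Sublist.Propositional.Properties using ()
  renaming (filter-⊆ to filter-⊑)
open import Relation.Nullary using (¬_; yes; no)
open import Relation.Unary using (Decidable)
open import Data.Empty using (⊥-elim)
open import Relation.Binary.PropositionalEquality using (_≡_; _≢_; refl; sym; trans; subst)
open import Function using (_∘_; id; case_of_)
open import Function.Bundles using (_⇔_; mk⇔; Equivalence)

module _ {n : ℕ} where

  gen-mono : ∀ {ys zs : List (B n)} → ys ⊆ zs → ∀ {a} → Gen ys a → Gen zs a
  gen-mono s (base m) = base (s m)
  gen-mono s (mul g h) = mul (gen-mono s g) (gen-mono s h)

  gen-empty : ∀ {a} → ¬ Gen {n} [] a
  gen-empty (base ())
  gen-empty (mul g _) = gen-empty g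

  gen-snoc-⊂ : ∀ (ys : List (B n)) x → (Gen ys ⊂ Gen (ys ++ [ x ])) ⇔ (¬ Gen ys x)
  gen-snoc-⊂ ys x = mk⇔ notGenerated enlarges
    where
    notGenerated : Gen ys ⊂ Gen (ys ++ [ x ]) → ¬ Gen ys x
    notGenerated (_ , w , gw , ¬gw) gx = ¬gw (dropX gw)
      where
      dropX : ∀ {a} → Gen (ys ++ [ x ]) a → Gen ys a
      dropX (base m) with ∈-++⁻ ys m
      ... | inj₁ p = base p
      ... | inj₂ (here refl) = gx
      dropX (mul g h) = mul (dropX g) (dropX h)
    enlarges : ¬ Gen ys x → Gen ys ⊂ Gen (ys ++ [ x ])
    enlarges ¬gx = (λ _ → gen-mono (xs⊆xs++ys ys [ x ])) , x , base (∈-++⁺ʳ ys (here refl)) , ¬gx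

  Chain : List (B n) → List (B n) → Set
  Chain acc [] = ⊤
  Chain acc (x ∷ xs) = ¬ Gen acc x × Chain (acc ++ [ x ]) xs

  StrictChainOver : List (B n) → List (B n) → Set
  StrictChainOver acc xs = (i : Fin (length xs)) →
    Gen (acc ++ take (toℕ i) xs) ⊂ Gen (acc ++ take (suc (toℕ i)) xs)

  strictChain⇔chain : ∀ acc xs → StrictChainOver acc xs ⇔ Chain acc xs
  strictChain⇔chain acc xs = mk⇔ (to acc xs) (from acc xs)
    where
    shift : ∀ acc x xs k → Gen ((acc ++ [ x ]) ++ take k xs) ⊂ Gen ((acc ++ [ x ]) ++ take (suc k) xs)
          ⇔ Gen (acc ++ take (suc k) (x ∷ xs)) ⊂ Gen (acc ++ take (suc (suc k)) (x ∷ xs))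
    shift acc x xs k rewrite ++-assoc acc [ x ] (take k xs) | ++-assoc acc [ x ] (take (suc k) xs) =
      mk⇔ (λ p → p) (λ p → p)
    first : ∀ acc x → (Gen (acc ++ []) ⊂ Gen (acc ++ [ x ])) ⇔ (¬ Gen acc x)
    first acc x rewrite ++-identityʳ acc = gen-snoc-⊂ acc x
    to : ∀ acc xs → StrictChainOver acc xs → Chain acc xs
    to acc [] _ = tt
    to acc (x ∷ xs) sc = Equivalence.to (first acc x) (sc fzero)
                       , to (acc ++ [ x ]) xs (λ i → Equivalence.from (shift acc x xs (toℕ i)) (sc (fsuc i)))
    from : ∀ acc xs → Chain acc xs → StrictChainOver acc xs
    from acc (x ∷ xs) (¬gx , c) fzero = Equivalence.from (first acc x) ¬gx
    from acc (x ∷ xs) (¬gx , c) (fsuc i) = Equivalence.to (shift acc x xs (toℕ i)) (from (acc ++ [ x ]) xs c i)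

  -- A chain stays a chain when elements are deleted from it and when its base
  -- is shrunk, because generated subsemigroups only grow with the generators.
  chain-sublist : ∀ {acc′ acc ys xs : List (B n)} → acc′ ⊆ acc → ys ⊑ xs → Chain acc xs → Chain acc′ ys
  chain-sublist s [] _ = tt
  chain-sublist s (x ∷ʳ p) (_ , c) = chain-sublist (λ m → ∈-++⁺ˡ (s m)) p c
  chain-sublist s (refl ∷ p) (¬gx , c) = ¬gx ∘ gen-mono s , chain-sublist (++⁺ˡ _ s) p c

  chain-++ : ∀ (acc es ys : List (B n)) → Chain acc es → Chain (acc ++ es) ys → Chain acc (es ++ ys)
  chain-++ acc [] ys _ c rewrite ++-identityʳ acc = c
  chain-++ acc (e ∷ es) ys (¬ge , c) d =
    ¬ge , chain-++ (acc ++ [ e ]) es ys c (subst (λ l → Chain l ys) (sym (++-assoc acc [ e ] es)) d)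

  chain-fresh : ∀ acc (xs : List (B n)) → Chain acc xs → All (_∉ acc) xs
  chain-fresh acc [] _ = []
  chain-fresh acc (x ∷ xs) (¬gx , c) =
    ¬gx ∘ base ∷ All.map (_∘ ∈-++⁺ˡ) (chain-fresh (acc ++ [ x ]) xs c)

  chain-unique : ∀ acc (xs : List (B n)) → Chain acc xs → Unique xs
  chain-unique acc [] _ = []
  chain-unique acc (x ∷ xs) (_ , c) =
    All.map (λ y∉ x≡y → y∉ (∈-++⁺ʳ acc (here (sym x≡y)))) (chain-fresh (acc ++ [ x ]) xs c)
    ∷ chain-unique (acc ++ [ x ]) xs c

  Idem : B n → Set
  Idem x = inE x ≡ true

  AllIdem : List (B n) → Set
  AllIdem es = ∀ {e} → e ∈ es → Idem e

  diag : Fin n → B n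
  diag i = just (i , i)

  diag-idem : ∀ i → Idem (diag i)
  diag-idem i with i ≟ᶠ i
  ... | yes _ = refl
  ... | no i≢i = ⊥-elim (i≢i refl)

  idem-diag : ∀ {i j : Fin n} → Idem (just (i , j)) → i ≡ j
  idem-diag {i} {j} e with i ≟ᶠ j
  ... | yes i≡j = i≡j
  idem-diag () | no _

  idem-left : ∀ (e b : B n) → Idem e → e · b ≡ zeroB ⊎ e · b ≡ b
  idem-left nothing b _ = inj₁ refl
  idem-left (just (i , j)) b e with idem-diag e
  idem-left (just (i , .i)) nothing _ | refl = inj₁ refl
  idem-left (just (i , .i)) (just (k , l)) _ | refl with i ≟ᶠ k
  ... | yes refl = inj₂ refl
  ... | no _ = inj₁ refl

  idem-right : ∀ (a e : B n) → Idem e → a · e ≡ zeroB ⊎ a · e ≡ a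
  idem-right nothing e _ = inj₁ refl
  idem-right (just _) nothing _ = inj₁ refl
  idem-right (just (k , l)) (just (i , j)) e with idem-diag e
  ... | refl with l ≟ᶠ i
  ...   | yes refl = inj₂ refl
  ...   | no _ = inj₁ refl

  _∈₀_ : B n → List (B n) → Set
  x ∈₀ es = x ≡ zeroB ⊎ x ∈ es

  ∈₀-idem : ∀ {es x} → AllIdem es → x ∈₀ es → Idem x
  ∈₀-idem _ (inj₁ refl) = refl
  ∈₀-idem ie (inj₂ m) = ie m

  gen-split : ∀ {es} acc → AllIdem es → ∀ {x} → Gen (es ++ acc) x → x ∈₀ es ⊎ Gen acc x
  gen-split {es} acc ie (base m) with ∈-++⁻ es m
  ... | inj₁ p = inj₁ (inj₂ p)
  ... | inj₂ p = inj₂ (base p)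
  gen-split {es} acc ie (mul {a} {b} g h) with gen-split acc ie g | gen-split acc ie h
  ... | inj₂ ga | inj₂ gb = inj₂ (mul ga gb)
  ... | inj₁ a₀ | rb with idem-left a b (∈₀-idem ie a₀)
  ...   | inj₁ ab≡0 = inj₁ (inj₁ ab≡0)
  ...   | inj₂ ab≡b = subst (λ z → z ∈₀ es ⊎ Gen acc z) (sym ab≡b) rb
  gen-split {es} acc ie (mul {a} {b} g h) | inj₂ ga | inj₁ b₀ with idem-right a b (∈₀-idem ie b₀)
  ...   | inj₁ ab≡0 = inj₁ (inj₁ ab≡0)
  ...   | inj₂ ab≡a = subst (λ z → z ∈₀ es ⊎ Gen acc z) (sym ab≡a) (inj₂ ga)

  gen-idempotents : ∀ {es} → AllIdem es → ∀ {x} → Gen es x → x ∈₀ es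
  gen-idempotents {es} ie g with gen-split [] ie (gen-mono (xs⊆xs++ys es []) g)
  ... | inj₁ x₀ = x₀
  ... | inj₂ g₀ = ⊥-elim (gen-empty g₀)

  chain-prepend-idempotents : ∀ {es} → AllIdem es → ∀ acc ys → All (λ y → inE y ≡ false) ys →
                              Chain acc ys → Chain (es ++ acc) ys
  chain-prepend-idempotents ie acc [] _ _ = tt
  chain-prepend-idempotents {es} ie acc (y ∷ ys) (y∉E ∷ ys∉E) (¬gy , c) =
    ¬gy′ , subst (λ l → Chain l ys) (sym (++-assoc es acc [ y ]))
                 (chain-prepend-idempotents ie (acc ++ [ y ]) ys ys∉E c)
    where
    ¬gy′ : ¬ Gen (es ++ acc) y
    ¬gy′ g with gen-split acc ie g
    ... | inj₁ y₀ = case trans (sym (∈₀-idem ie y₀)) y∉E of λ ()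
    ... | inj₂ gy = ¬gy gy

  chain-idempotents : ∀ acc xs → AllIdem acc → All (λ x → Idem x × x ≢ zeroB × x ∉ acc) xs →
                      Unique xs → Chain acc xs
  chain-idempotents acc [] _ _ _ = tt
  chain-idempotents acc (x ∷ xs) ie ((x-idem , x≢0 , x∉acc) ∷ hs) (x∉xs ∷ u) =
    ¬gx , chain-idempotents (acc ++ [ x ]) xs ie′ (All.zipWith extend (x∉xs , hs)) u
    where
    ¬gx : ¬ Gen acc x
    ¬gx g with gen-idempotents ie g
    ... | inj₁ x≡0 = x≢0 x≡0
    ... | inj₂ x∈acc = x∉acc x∈acc
    ie′ : AllIdem (acc ++ [ x ])
    ie′ m with ∈-++⁻ acc m
    ... | inj₁ p = ie p
    ... | inj₂ (here refl) = x-idem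
    extend : ∀ {y} → x ≢ y × (Idem y × y ≢ zeroB × y ∉ acc) → Idem y × y ≢ zeroB × y ∉ acc ++ [ x ]
    extend (x≢y , y-idem , y≢0 , y∉acc) = y-idem , y≢0 , λ m → case ∈-++⁻ acc m of λ where
      (inj₁ p) → y∉acc p
      (inj₂ (here y≡x)) → x≢y (sym y≡x)

  allIdem : List (B n)
  allIdem = zeroB ∷ map diag (allFin n)

  ∈-allIdem : ∀ x → x ∈ allIdem ⇔ Idem x
  ∈-allIdem x = mk⇔ (to x) (from x)
    where
    to : ∀ x → x ∈ allIdem → Idem x
    to _ (here refl) = refl
    to _ (there m) with ∈-map⁻ diag m
    ... | i , _ , refl = diag-idem i
    from : ∀ x → Idem x → x ∈ allIdem
    from nothing _ = here refl
    from (just (i , j)) e with idem-diag e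
    ... | refl = there (∈-map⁺ diag (∈-allFin i))

  allIdem-chain : Chain [] allIdem
  allIdem-chain = gen-empty , chain-idempotents [ zeroB ] (map diag (allFin n))
    (λ { (here refl) → refl }) (All.tabulate diagonal) (map⁺ diag-injective (allFin⁺ n))
    where
    diagonal : ∀ {x} → x ∈ map diag (allFin n) → Idem x × x ≢ zeroB × x ∉ [ zeroB ]
    diagonal m with ∈-map⁻ diag m
    ... | i , _ , refl = diag-idem i , (λ ()) , λ { (here ()) }
    diag-injective : ∀ {i j} → diag i ≡ diag j → i ≡ j
    diag-injective refl = refl

  Enumerates : Subset n → List (B n) → Set
  Enumerates X xs = ∀ x → (x ∈ xs) ⇔ (X x ≡ true)

  ChainFace : Subset n → Set
  ChainFace X = Σ[ xs ∈ List (B n) ] (Enumerates X xs × Chain [] xs)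

  isFace⇔chainFace : ∀ X → IsFace X ⇔ ChainFace X
  isFace⇔chainFace X = mk⇔
    (λ (xs , _ , enum , sc) → xs , enum , Equivalence.to (strictChain⇔chain [] xs) sc)
    (λ (xs , enum , c) → xs , chain-unique [] xs c , enum , Equivalence.from (strictChain⇔chain [] xs) c)

  ∖E-true : ∀ (X : Subset n) x → (X ∖E) x ≡ true ⇔ (X x ≡ true × inE x ≡ false)
  ∖E-true X x = mk⇔ (to (X x) (inE x)) (from (X x) (inE x))
    where
    to : ∀ a b → (a ∧ not b) ≡ true → a ≡ true × b ≡ false
    to true false refl = refl , refl
    from : ∀ a b → a ≡ true × b ≡ false → (a ∧ not b) ≡ true
    from true false (refl , refl) = refl

  drop-idempotents : ∀ X → ChainFace X → ChainFace (X ∖E)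
  drop-idempotents X (xs , enum , c) =
    filter nonIdem? xs , enum′ , chain-sublist id (filter-⊑ nonIdem? xs) c
    where
    nonIdem? : Decidable (λ (x : B n) → inE x ≡ false)
    nonIdem? x = inE x ≟ᵇ false
    enum′ : Enumerates (X ∖E) (filter nonIdem? xs)
    enum′ x = mk⇔
      (λ m → let (x∈xs , x∉E) = ∈-filter⁻ nonIdem? m in
             Equivalence.from (∖E-true X x) (Equivalence.to (enum x) x∈xs , x∉E))
      (λ h → let (Xx , x∉E) = Equivalence.to (∖E-true X x) h in
             ∈-filter⁺ nonIdem? (Equivalence.from (enum x) Xx) x∉E)

  add-idempotents : ∀ X → ChainFace (X ∖E) → ChainFace X
  add-idempotents X (ys , enum , c) = es ++ ys , enum′ , chain-++ [] es ys es-chain ys-chain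
    where
    inX? : Decidable (λ (x : B n) → X x ≡ true)
    inX? x = X x ≟ᵇ true
    es : List (B n)
    es = filter inX? allIdem
    es-chain : Chain [] es
    es-chain = chain-sublist id (filter-⊑ inX? allIdem) allIdem-chain
    es-idem : AllIdem es
    es-idem {e} m = Equivalence.to (∈-allIdem e) (proj₁ (∈-filter⁻ inX? m))
    ys∉E : All (λ y → inE y ≡ false) ys
    ys∉E = All.tabulate (λ {y} m → proj₂ (Equivalence.to (∖E-true X y) (Equivalence.to (enum y) m)))
    ys-chain : Chain es ys
    ys-chain = subst (λ l → Chain l ys) (++-identityʳ es) (chain-prepend-idempotents es-idem [] ys ys∉E c)
    enum′ : Enumerates X (es ++ ys)
    enum′ x = mk⇔ to from
      where
      to : x ∈ es ++ ys → X x ≡ true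
      to m with ∈-++⁻ es m
      ... | inj₁ p = proj₂ (∈-filter⁻ inX? p)
      ... | inj₂ p = proj₁ (Equivalence.to (∖E-true X x) (Equivalence.to (enum x) p))
      from : X x ≡ true → x ∈ es ++ ys
      from Xx with inE x in eq
      ... | true = ∈-++⁺ˡ (∈-filter⁺ inX? (Equivalence.from (∈-allIdem x) eq) Xx)
      ... | false = ∈-++⁺ʳ es (Equivalence.from (enum x) (Equivalence.from (∖E-true X x) (Xx , eq)))

-- The theorem.
lemma5p12 : (n : ℕ) → 1 ≤ n → (X : Subset n) → IsFace X ⇔ IsFace (X ∖E)
lemma5p12 n _ X = mk⇔
  (λ face → from (X ∖E) (drop-idempotents X (to X face)))
  (λ face → from X (add-idempotents X (to (X ∖E) face)))
  where
  to : ∀ Y → IsFace Y → ChainFace Y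
  to Y = Equivalence.to (isFace⇔chainFace Y)
  from : ∀ Y → ChainFace Y → IsFace Y
  from Y = Equivalence.from (isFace⇔chainFace Y)
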